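{- Let $n\geqslant 4$ and let $H$ be a Hadamard matrix of order $n$. If all quadruples of distinct rows of $H$ have the same type, then $n=4$ or $n=12$.
   Context: A Hadamard matrix of order $n$ is an $n\times n$ matrix $H=(h_{uv})$ with entries in $\{ -1,1\}$ such that $HH^\top=nI$. For four distinct rows $i,j,k,\ell$ of $H$, put $P_{ijk\ell}=\left|\sum_{r=1}^n h_{ir}h_{jr}h_{kr}h_{\ell r}\right|$; the type of the quadruple $\{i,j,k,\ell\}$ is $T_{ijk\ell}=\frac{n-P_{ijk\ell}}{8}$. -}

module Defs where

open import Data.Nat using (ℕ; zero; suc)
open import Data.Fin using (Fin; zero; suc)
open import Data.Integer using (ℤ; +_; -[1+_]; _+_; _*_; _-_; ∣_∣)
open import Data.Rational using (ℚ; _/_)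
open import Data.Sum using (_⊎_)
open import Data.Product using (_×_)
open import Relation.Binary.PropositionalEquality using (_≡_; _≢_)

Matrix : ℕ → Set
Matrix n = Fin n → Fin n → ℤ

Σ : (n : ℕ) → (Fin n → ℤ) → ℤ
Σ zero    f = + 0
Σ (suc n) f = f zero + Σ n (λ r → f (suc r))

record IsHadamard (n : ℕ) (H : Matrix n) : Set where
  field
    entries  : ∀ i j → (H i j ≡ + 1) ⊎ (H i j ≡ -[1+ 0 ])
    diagonal : ∀ i → Σ n (λ r → H i r * H i r) ≡ + n
    offdiag  : ∀ i j → i ≢ j → Σ n (λ r → H i r * H j r) ≡ + 0

P : (n : ℕ) → Matrix n → Fin n → Fin n → Fin n → Fin n → ℕ
P n H i j k l = ∣ Σ n (λ r → H i r * H j r * H k r * H l r) ∣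

T : (n : ℕ) → Matrix n → Fin n → Fin n → Fin n → Fin n → ℚ
T n H i j k l = (+ n - + P n H i j k l) / 8

Distinct4 : ∀ {n} → Fin n → Fin n → Fin n → Fin n → Set
Distinct4 i j k l =
  i ≢ j × i ≢ k × i ≢ l × j ≢ k × j ≢ l × k ≢ l

AllSameType : (n : ℕ) → Matrix n → Set
AllSameType n H =
  ∀ i j k l i′ j′ k′ l′ → Distinct4 i j k l → Distinct4 i′ j′ k′ l′ →
  T n H i j k l ≡ T n H i′ j′ k′ l′

-- Fix three rows i, j, k of H and let x be their entrywise product, a ±1 vector. From HHᵀ = nI a
-- trace computation gives HᵀH = nI, so Parseval holds: Σₗ ⟨x, Hₗ⟩² = n‖x‖² = n². The terms
-- l ∈ {i, j, k} vanish because distinct rows are orthogonal, and ⟨x, Hₗ⟩ = ±P_{ijkl}, which is the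
-- same number p for every other l when all quadruples have the same type. Hence n² = (n − 3)p²,
-- so n − 3 divides 9; n − 3 = 3 would force p² = 12, which leaves n = 4 and n = 12.

module Submission where

open import Defs
open import Data.Nat using (ℕ; _≥_)
open import Data.Sum using (_⊎_)
open import Relation.Binary.PropositionalEquality using (_≡_)

open import Data.Nat as ℕ using (zero; suc; s≤s; z≤n)
import Data.Nat.Properties as ℕP
open import Data.Nat.Properties using (allUpTo?; anyUpTo?)
open import Data.Nat.Divisibility using (_∣_; _∣?_; ∣⇒≤; ∣m+n∣m⇒∣n; m∣m*n)
import Data.Nat.Tactic.RingSolver as ℕ-Ring
open import Data.Fin using (Fin; zero; suc; _≟_)
open import Data.Fin.Patterns using (0F; 1F; 2F; 3F)
open import Data.Integer using (ℤ; +_; -[1+_]; 0ℤ; 1ℤ; -1ℤ; _+_; _*_; _-_; -_; ∣_∣; _≤_; +≤+)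
import Data.Integer.Properties as ℤP
open import Data.Integer.Tactic.RingSolver using (solve-∀)
open import Algebra.Properties.Semiring.Sum ℤP.+-*-semiring
  using (sum; sum-syntax; sum-cong-≗; sum-replicate-zero; ∑-comm; ∑-distrib-+; *-distribˡ-sum; *-distribʳ-sum)
open import Data.Rational using (_/_)
open import Data.Rational.Properties using (/-injective-≃)
open import Data.Rational.Unnormalised using (mkℚᵘ; *≡*)
open import Data.Product using (_×_; _,_; proj₁; proj₂)
open import Data.Sum using (inj₁; inj₂; reduce)
import Data.Sum as Sum
open import Function using (_∘_)
open import Relation.Nullary using (yes; no; contradiction)
open import Relation.Nullary.Decidable using (from-yes; from-no; _→-dec_; _⊎-dec_)
open import Relation.Binary.PropositionalEquality using (_≢_; refl; sym; trans; cong; cong₂; subst; module ≡-Reasoning)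
open ≡-Reasoning

Σ≡sum : ∀ n (f : Fin n → ℤ) → Σ n f ≡ sum f
Σ≡sum zero    f = refl
Σ≡sum (suc n) f = cong (λ s → f zero + s) (Σ≡sum n (f ∘ suc))

sum-const : ∀ n c → ∑[ i < n ] c ≡ + n * c
sum-const zero    c = refl
sum-const (suc n) c = begin
  c + ∑[ i < n ] c   ≡⟨ cong (λ s → c + s) (sum-const n c) ⟩
  c + + n * c        ≡⟨ cong (λ s → s + + n * c) (ℤP.*-identityˡ c) ⟨
  1ℤ * c + + n * c   ≡⟨ ℤP.*-distribʳ-+ c 1ℤ (+ n) ⟨
  + suc n * c        ∎

sum-*-sum : ∀ {m n} (f : Fin m → ℤ) (g : Fin n → ℤ) →
            sum f * sum g ≡ ∑[ a < m ] ∑[ b < n ] (f a * g b)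
sum-*-sum f g = trans (*-distribʳ-sum (sum g) f) (sum-cong-≗ (λ a → *-distribˡ-sum (f a) g))

δ : ∀ {n} → Fin n → Fin n → ℤ
δ zero    zero    = 1ℤ
δ zero    (suc _) = 0ℤ
δ (suc _) zero    = 0ℤ
δ (suc i) (suc j) = δ i j

δ-refl : ∀ {n} (i : Fin n) → δ i i ≡ 1ℤ
δ-refl zero    = refl
δ-refl (suc i) = δ-refl i

δ-≢ : ∀ {n} {i j : Fin n} → i ≢ j → δ i j ≡ 0ℤ
δ-≢ {i = zero}  {zero}  i≢j = contradiction refl i≢j
δ-≢ {i = zero}  {suc j} _   = refl
δ-≢ {i = suc i} {zero}  _   = refl
δ-≢ {i = suc i} {suc j} i≢j = δ-≢ (i≢j ∘ cong suc)

sum-δ : ∀ {n} (i : Fin n) (f : Fin n → ℤ) → ∑[ j < n ] (δ i j * f j) ≡ f i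
sum-δ {suc n} zero    f = begin
  1ℤ * f zero + ∑[ j < n ] 0ℤ  ≡⟨ cong₂ _+_ (ℤP.*-identityˡ (f zero)) (sum-replicate-zero n) ⟩
  f zero + 0ℤ                  ≡⟨ ℤP.+-identityʳ (f zero) ⟩
  f zero                       ∎
sum-δ {suc n} (suc i) f = trans (ℤP.+-identityˡ _) (sum-δ i (f ∘ suc))

i*i≡∣i∣*∣i∣ : ∀ i → i * i ≡ + (∣ i ∣ ℕ.* ∣ i ∣)
i*i≡∣i∣*∣i∣ (+ m)    = ℤP.+◃n≡+n (m ℕ.* m)
i*i≡∣i∣*∣i∣ -[1+ m ] = refl

0≤i*i : ∀ i → 0ℤ ≤ i * i
0≤i*i i = subst (0ℤ ≤_) (sym (i*i≡∣i∣*∣i∣ i)) (+≤+ z≤n)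

0≤sum : ∀ {n} {f : Fin n → ℤ} → (∀ i → 0ℤ ≤ f i) → 0ℤ ≤ sum f
0≤sum {zero}  _   = +≤+ z≤n
0≤sum {suc n} 0≤f = ℤP.+-mono-≤ (0≤f zero) (0≤sum (0≤f ∘ suc))

nonneg+nonneg≡0 : ∀ {i j} → 0ℤ ≤ i → 0ℤ ≤ j → i + j ≡ 0ℤ → i ≡ 0ℤ × j ≡ 0ℤ
nonneg+nonneg≡0 (+≤+ {n = a} _) (+≤+ _) a+b≡0 =
  cong +_ (ℕP.m+n≡0⇒m≡0 a a+b≡0′) , cong +_ (ℕP.m+n≡0⇒n≡0 a a+b≡0′)
  where
  a+b≡0′ : a ℕ.+ _ ≡ 0
  a+b≡0′ = ℤP.+-injective a+b≡0

sum-nonneg≡0 : ∀ {n} {f : Fin n → ℤ} → (∀ i → 0ℤ ≤ f i) → sum f ≡ 0ℤ → ∀ i → f i ≡ 0ℤ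
sum-nonneg≡0 {suc n} 0≤f Σf≡0 zero    = proj₁ (nonneg+nonneg≡0 (0≤f zero) (0≤sum (0≤f ∘ suc)) Σf≡0)
sum-nonneg≡0 {suc n} 0≤f Σf≡0 (suc i) =
  sum-nonneg≡0 (0≤f ∘ suc) (proj₂ (nonneg+nonneg≡0 (0≤f zero) (0≤sum (0≤f ∘ suc)) Σf≡0)) i

transpose : ∀ {n} → Matrix n → Matrix n
transpose A i j = A j i

gram : ∀ {n} → Matrix n → Matrix n
gram {n} A i j = ∑[ r < n ] (A i r * A j r)

trace : ∀ {n} → Matrix n → ℤ
trace {n} A = ∑[ i < n ] A i i

frobenius² : ∀ {n} → Matrix n → ℤ
frobenius² {n} A = ∑[ i < n ] ∑[ j < n ] (A i j * A i j)

∑∑-comm : ∀ {m n} (f : Fin m → Fin m → Fin n → Fin n → ℤ) →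
          ∑[ a < m ] ∑[ b < m ] ∑[ c < n ] ∑[ d < n ] f a b c d ≡
          ∑[ c < n ] ∑[ d < n ] ∑[ a < m ] ∑[ b < m ] f a b c d
∑∑-comm {m} {n} f = begin
  ∑[ a < m ] ∑[ b < m ] ∑[ c < n ] ∑[ d < n ] f a b c d
    ≡⟨ sum-cong-≗ (λ a → ∑-comm (λ b c → ∑[ d < n ] f a b c d)) ⟩
  ∑[ a < m ] ∑[ c < n ] ∑[ b < m ] ∑[ d < n ] f a b c d
    ≡⟨ ∑-comm (λ a c → ∑[ b < m ] ∑[ d < n ] f a b c d) ⟩
  ∑[ c < n ] ∑[ a < m ] ∑[ b < m ] ∑[ d < n ] f a b c d
    ≡⟨ sum-cong-≗ (λ c → sum-cong-≗ (λ a → ∑-comm (λ b d → f a b c d))) ⟩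
  ∑[ c < n ] ∑[ a < m ] ∑[ d < n ] ∑[ b < m ] f a b c d
    ≡⟨ sum-cong-≗ (λ c → ∑-comm (λ a d → ∑[ b < m ] f a b c d)) ⟩
  ∑[ c < n ] ∑[ d < n ] ∑[ a < m ] ∑[ b < m ] f a b c d
    ∎

trace-gram-transpose : ∀ {n} (A : Matrix n) → trace (gram (transpose A)) ≡ trace (gram A)
trace-gram-transpose A = ∑-comm (λ i r → A r i * A r i)

frobenius²-gram-transpose : ∀ {n} (A : Matrix n) →
                            frobenius² (gram (transpose A)) ≡ frobenius² (gram A)
frobenius²-gram-transpose {n} A = begin
  frobenius² (gram (transpose A))
    ≡⟨ sum-cong-≗ (λ r → sum-cong-≗ (λ s →
         sum-*-sum (λ i → A i r * A i s) (λ j → A j r * A j s))) ⟩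
  ∑[ r < n ] ∑[ s < n ] ∑[ i < n ] ∑[ j < n ] ((A i r * A i s) * (A j r * A j s))
    ≡⟨ ∑∑-comm (λ r s i j → (A i r * A i s) * (A j r * A j s)) ⟩
  ∑[ i < n ] ∑[ j < n ] ∑[ r < n ] ∑[ s < n ] ((A i r * A i s) * (A j r * A j s))
    ≡⟨ sum-cong-≗ (λ i → sum-cong-≗ (λ j → sum-cong-≗ (λ r → sum-cong-≗ (λ s →
         interchange (A i r) (A i s) (A j r) (A j s))))) ⟩
  ∑[ i < n ] ∑[ j < n ] ∑[ r < n ] ∑[ s < n ] ((A i r * A j r) * (A i s * A j s))
    ≡⟨ sum-cong-≗ (λ i → sum-cong-≗ (λ j →
         sum-*-sum (λ r → A i r * A j r) (λ s → A i s * A j s))) ⟨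
  frobenius² (gram A)
    ∎
  where
  interchange : ∀ a b c d → (a * b) * (c * d) ≡ (a * c) * (b * d)
  interchange = solve-∀

frobenius²-sub-scalar : ∀ {n} (A : Matrix n) c →
  frobenius² (λ i j → A i j - c * δ i j) ≡ frobenius² A - + 2 * c * trace A + + n * (c * c)
frobenius²-sub-scalar {n} A c = begin
  frobenius² (λ i j → A i j - c * δ i j)
    ≡⟨ sum-cong-≗ row ⟩
  ∑[ i < n ] (R i + (c * c + k * A i i))
    ≡⟨ ∑-distrib-+ R _ ⟩
  frobenius² A + ∑[ i < n ] (c * c + k * A i i)
    ≡⟨ cong (λ s → frobenius² A + s) (∑-distrib-+ (λ _ → c * c) (λ i → k * A i i)) ⟩
  frobenius² A + (∑[ i < n ] (c * c) + ∑[ i < n ] (k * A i i))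
    ≡⟨ cong₂ (λ s t → frobenius² A + (s + t)) (sum-const n (c * c)) (sym (*-distribˡ-sum k (λ i → A i i))) ⟩
  frobenius² A + (+ n * (c * c) + k * trace A)
    ≡⟨ regroup (frobenius² A) (+ n) c (trace A) ⟩
  frobenius² A - + 2 * c * trace A + + n * (c * c)
    ∎
  where
  k : ℤ
  k = - (+ 2 * c)
  R : Fin n → ℤ
  R i = ∑[ j < n ] (A i j * A i j)
  expand : ∀ a c d → (a - c * d) * (a - c * d) ≡ a * a + d * (c * c * d + - (+ 2 * c) * a)
  expand = solve-∀
  regroup : ∀ f m c t → f + (m * (c * c) + - (+ 2 * c) * t) ≡ f - + 2 * c * t + m * (c * c)
  regroup = solve-∀
  row : ∀ i → ∑[ j < n ] ((A i j - c * δ i j) * (A i j - c * δ i j)) ≡ R i + (c * c + k * A i i)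
  row i = begin
    ∑[ j < n ] ((A i j - c * δ i j) * (A i j - c * δ i j))
      ≡⟨ sum-cong-≗ (λ j → expand (A i j) c (δ i j)) ⟩
    ∑[ j < n ] (A i j * A i j + δ i j * (c * c * δ i j + k * A i j))
      ≡⟨ ∑-distrib-+ (λ j → A i j * A i j) (λ j → δ i j * (c * c * δ i j + k * A i j)) ⟩
    R i + ∑[ j < n ] (δ i j * (c * c * δ i j + k * A i j))
      ≡⟨ cong (λ s → R i + s) (sum-δ i _) ⟩
    R i + (c * c * δ i i + k * A i i)
      ≡⟨ cong (λ d → R i + (c * c * d + k * A i i)) (δ-refl i) ⟩
    R i + (c * c * 1ℤ + k * A i i)
      ≡⟨ cong (λ s → R i + (s + k * A i i)) (ℤP.*-identityʳ (c * c)) ⟩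
    R i + (c * c + k * A i i)
      ∎

frobenius²-scalar : ∀ {n} c → frobenius² {n} (λ i j → c * δ i j) ≡ + n * (c * c)
frobenius²-scalar {n} c = trans (sum-cong-≗ row) (sum-const n (c * c))
  where
  pull-δ : ∀ c d → (c * d) * (c * d) ≡ d * (c * (c * d))
  pull-δ = solve-∀
  row : ∀ i → ∑[ j < n ] ((c * δ i j) * (c * δ i j)) ≡ c * c
  row i = begin
    ∑[ j < n ] ((c * δ i j) * (c * δ i j))  ≡⟨ sum-cong-≗ (λ j → pull-δ c (δ i j)) ⟩
    ∑[ j < n ] (δ i j * (c * (c * δ i j)))  ≡⟨ sum-δ i (λ j → c * (c * δ i j)) ⟩
    c * (c * δ i i)                         ≡⟨ cong (λ d → c * (c * d)) (δ-refl i) ⟩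
    c * (c * 1ℤ)                            ≡⟨ cong (c *_) (ℤP.*-identityʳ c) ⟩
    c * c                                   ∎

frobenius²≡0 : ∀ {n} (A : Matrix n) → frobenius² A ≡ 0ℤ → ∀ i j → A i j ≡ 0ℤ
frobenius²≡0 A ‖A‖²≡0 i j = square≡0 (sum-nonneg≡0 (0≤i*i ∘ A i) (row≡0 i) j)
  where
  row≡0 : ∀ i → ∑[ j < _ ] (A i j * A i j) ≡ 0ℤ
  row≡0 = sum-nonneg≡0 (λ i → 0≤sum (0≤i*i ∘ A i)) ‖A‖²≡0
  square≡0 : ∀ {a} → a * a ≡ 0ℤ → a ≡ 0ℤ
  square≡0 {a} a²≡0 = reduce (ℤP.i*j≡0⇒i≡0∨j≡0 a a²≡0)

-- The trace argument: ‖AᵀA − cI‖² = ‖AAᵀ‖² − 2c·tr(AAᵀ) + nc² = nc² − 2c·nc + nc² = 0.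
AAᵀ≡cI⇒AᵀA≡cI : ∀ {n} (A : Matrix n) c → (∀ i j → gram A i j ≡ c * δ i j) →
                ∀ i j → gram (transpose A) i j ≡ c * δ i j
AAᵀ≡cI⇒AᵀA≡cI {n} A c AAᵀ≡cI i j =
  ℤP.i-j≡0⇒i≡j _ _ (frobenius²≡0 (λ i j → G i j - c * δ i j) deviation≡0 i j)
  where
  G : Matrix n
  G = gram (transpose A)
  trace-G : trace G ≡ + n * c
  trace-G = begin
    trace G                 ≡⟨ trace-gram-transpose A ⟩
    ∑[ i < n ] gram A i i   ≡⟨ sum-cong-≗ (λ i → trans (AAᵀ≡cI i i) (cong (c *_) (δ-refl i))) ⟩
    ∑[ i < n ] (c * 1ℤ)     ≡⟨ sum-const n (c * 1ℤ) ⟩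
    + n * (c * 1ℤ)          ≡⟨ cong (λ t → + n * t) (ℤP.*-identityʳ c) ⟩
    + n * c                 ∎
  frobenius²-G : frobenius² G ≡ + n * (c * c)
  frobenius²-G = begin
    frobenius² G
      ≡⟨ frobenius²-gram-transpose A ⟩
    frobenius² (gram A)
      ≡⟨ sum-cong-≗ (λ i → sum-cong-≗ (λ j → cong₂ _*_ (AAᵀ≡cI i j) (AAᵀ≡cI i j))) ⟩
    frobenius² {n} (λ i j → c * δ i j)
      ≡⟨ frobenius²-scalar {n} c ⟩
    + n * (c * c)
      ∎
  cancel : ∀ m c → m * (c * c) - + 2 * c * (m * c) + m * (c * c) ≡ 0ℤ
  cancel = solve-∀
  deviation≡0 : frobenius² (λ i j → G i j - c * δ i j) ≡ 0ℤ
  deviation≡0 = begin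
    frobenius² (λ i j → G i j - c * δ i j)
      ≡⟨ frobenius²-sub-scalar G c ⟩
    frobenius² G - + 2 * c * trace G + + n * (c * c)
      ≡⟨ cong₂ (λ f t → f - + 2 * c * t + + n * (c * c)) frobenius²-G trace-G ⟩
    + n * (c * c) - + 2 * c * (+ n * c) + + n * (c * c)
      ≡⟨ cancel (+ n) c ⟩
    0ℤ
      ∎

AᵀA≡cI⇒∑[Ax]²≡c∑x² : ∀ {n} (A : Matrix n) c → (∀ i j → gram (transpose A) i j ≡ c * δ i j) →
  ∀ (x : Fin n → ℤ) → ∑[ l < n ] ((∑[ r < n ] (x r * A l r)) * (∑[ s < n ] (x s * A l s))) ≡
                      c * ∑[ r < n ] (x r * x r)
AᵀA≡cI⇒∑[Ax]²≡c∑x² {n} A c AᵀA≡cI x = begin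
  ∑[ l < n ] ((∑[ r < n ] (x r * A l r)) * (∑[ s < n ] (x s * A l s)))
    ≡⟨ sum-cong-≗ (λ l → sum-*-sum (λ r → x r * A l r) (λ s → x s * A l s)) ⟩
  ∑[ l < n ] ∑[ r < n ] ∑[ s < n ] ((x r * A l r) * (x s * A l s))
    ≡⟨ ∑-comm (λ l r → ∑[ s < n ] ((x r * A l r) * (x s * A l s))) ⟩
  ∑[ r < n ] ∑[ l < n ] ∑[ s < n ] ((x r * A l r) * (x s * A l s))
    ≡⟨ sum-cong-≗ (λ r → ∑-comm (λ l s → (x r * A l r) * (x s * A l s))) ⟩
  ∑[ r < n ] ∑[ s < n ] ∑[ l < n ] ((x r * A l r) * (x s * A l s))
    ≡⟨ sum-cong-≗ (λ r → sum-cong-≗ (λ s → column-pair r s)) ⟩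
  ∑[ r < n ] ∑[ s < n ] (δ r s * (c * x r * x s))
    ≡⟨ sum-cong-≗ (λ r → sum-δ r (λ s → c * x r * x s)) ⟩
  ∑[ r < n ] (c * x r * x r)
    ≡⟨ sum-cong-≗ (λ r → ℤP.*-assoc c (x r) (x r)) ⟩
  ∑[ r < n ] (c * (x r * x r))
    ≡⟨ *-distribˡ-sum c (λ r → x r * x r) ⟨
  c * ∑[ r < n ] (x r * x r)
    ∎
  where
  interchange : ∀ a b c d → (a * b) * (c * d) ≡ (a * c) * (b * d)
  interchange = solve-∀
  regroup : ∀ a b c d → (a * b) * (c * d) ≡ d * (c * a * b)
  regroup = solve-∀
  column-pair : ∀ r s → ∑[ l < n ] ((x r * A l r) * (x s * A l s)) ≡ δ r s * (c * x r * x s)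
  column-pair r s = begin
    ∑[ l < n ] ((x r * A l r) * (x s * A l s))
      ≡⟨ sum-cong-≗ (λ l → interchange (x r) (A l r) (x s) (A l s)) ⟩
    ∑[ l < n ] ((x r * x s) * (A l r * A l s))
      ≡⟨ *-distribˡ-sum (x r * x s) (λ l → A l r * A l s) ⟨
    (x r * x s) * gram (transpose A) r s
      ≡⟨ cong ((x r * x s) *_) (AᵀA≡cI r s) ⟩
    (x r * x s) * (c * δ r s)
      ≡⟨ regroup (x r) (x s) c (δ r s) ⟩
    δ r s * (c * x r * x s)
      ∎

divisors-of-9 : ∀ {d} → d ∣ 9 → d ≡ 1 ⊎ d ≡ 3 ⊎ d ≡ 9
divisors-of-9 d∣9 =
  from-yes (allUpTo? (λ d → d ∣? 9 →-dec (d ℕ.≟ 1 ⊎-dec d ℕ.≟ 3 ⊎-dec d ℕ.≟ 9)) 10)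
    (s≤s (∣⇒≤ d∣9)) d∣9

12-not-square : ∀ p → p ℕ.* p ≢ 12
12-not-square zero ()
12-not-square p@(suc _) p²≡12 =
  from-no (anyUpTo? (λ q → q ℕ.* q ℕ.≟ 12) 13)
    (p , s≤s (subst (p ℕ.≤_) p²≡12 (ℕP.m≤m*n p p)) , p²≡12)

∣[3+m]²⇒∣9 : ∀ m → m ∣ (3 ℕ.+ m) ℕ.* (3 ℕ.+ m) → m ∣ 9
∣[3+m]²⇒∣9 m m∣[3+m]² = ∣m+n∣m⇒∣n (subst (m ∣_) (expand m) m∣[3+m]²) (m∣m*n (m ℕ.+ 6))
  where
  expand : ∀ m → (3 ℕ.+ m) ℕ.* (3 ℕ.+ m) ≡ m ℕ.* (m ℕ.+ 6) ℕ.+ 9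
  expand = ℕ-Ring.solve-∀

[3+m]²≡m*p²⇒m≡1⊎m≡9 : ∀ m p → (3 ℕ.+ m) ℕ.* (3 ℕ.+ m) ≡ m ℕ.* (p ℕ.* p) → m ≡ 1 ⊎ m ≡ 9
[3+m]²≡m*p²⇒m≡1⊎m≡9 m p eq
  with divisors-of-9 (∣[3+m]²⇒∣9 m (subst (m ∣_) (sym eq) (m∣m*n (p ℕ.* p))))
... | inj₁ m≡1        = inj₁ m≡1
... | inj₂ (inj₂ m≡9) = inj₂ m≡9
... | inj₂ (inj₁ refl) = contradiction (ℕP.*-cancelˡ-≡ 12 (p ℕ.* p) 3 eq) (12-not-square p ∘ sym)

±1-square : ∀ {a} → a ≡ 1ℤ ⊎ a ≡ -1ℤ → a * a ≡ 1ℤ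
±1-square (inj₁ refl) = refl
±1-square (inj₂ refl) = refl

-- mkℚᵘ a 7 is a/8: the denominator is stored minus one.
/8-injective : ∀ a b → a / 8 ≡ b / 8 → a ≡ b
/8-injective a b a/8≡b/8 with /-injective-≃ (mkℚᵘ a 7) (mkℚᵘ b 7) a/8≡b/8
... | *≡* a*8≡b*8 = ℤP.*-cancelʳ-≡ a b (+ 8) a*8≡b*8

T-injective : ∀ {n} (H : Matrix n) {i j k l i′ j′ k′ l′} →
              T n H i j k l ≡ T n H i′ j′ k′ l′ → P n H i j k l ≡ P n H i′ j′ k′ l′
T-injective {n} H {i} {j} {k} {l} {i′} {j′} {k′} {l′} T≡T′ = ℤP.+-injective (begin
  + p                 ≡⟨ sub-sub (+ n) (+ p) ⟨
  + n - (+ n - + p)   ≡⟨ cong (λ t → + n - t) (/8-injective (+ n - + p) (+ n - + p′) T≡T′) ⟩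
  + n - (+ n - + p′)  ≡⟨ sub-sub (+ n) (+ p′) ⟩
  + p′                ∎)
  where
  p p′ : ℕ
  p  = P n H i j k l
  p′ = P n H i′ j′ k′ l′
  sub-sub : ∀ a b → a - (a - b) ≡ b
  sub-sub = solve-∀

module Hadamard {n} {H : Matrix n} (hadamard : IsHadamard n H) where
  open IsHadamard hadamard

  gram-≢ : ∀ {i j} → i ≢ j → gram H i j ≡ 0ℤ
  gram-≢ {i} {j} i≢j = trans (sym (Σ≡sum n (λ r → H i r * H j r))) (offdiag i j i≢j)

  rows-orthogonal : ∀ i j → gram H i j ≡ + n * δ i j
  rows-orthogonal i j with i ≟ j
  ... | yes refl = begin
    gram H i i                 ≡⟨ Σ≡sum n (λ r → H i r * H i r) ⟨
    Σ n (λ r → H i r * H i r)  ≡⟨ diagonal i ⟩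
    + n                        ≡⟨ ℤP.*-identityʳ (+ n) ⟨
    + n * 1ℤ                   ≡⟨ cong (λ t → + n * t) (δ-refl i) ⟨
    + n * δ i i                ∎
  ... | no i≢j = begin
    gram H i j                 ≡⟨ gram-≢ i≢j ⟩
    0ℤ                         ≡⟨ ℤP.*-zeroʳ (+ n) ⟨
    + n * 0ℤ                   ≡⟨ cong (λ t → + n * t) (δ-≢ i≢j) ⟨
    + n * δ i j                ∎

  quadruple : Fin n → Fin n → Fin n → Fin n → ℤ
  quadruple i j k l = ∑[ r < n ] (H i r * H j r * H k r * H l r)

  P≡∣quadruple∣ : ∀ i j k l → P n H i j k l ≡ ∣ quadruple i j k l ∣
  P≡∣quadruple∣ i j k l = cong ∣_∣ (Σ≡sum n (λ r → H i r * H j r * H k r * H l r))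

  entry² : ∀ i r → H i r * H i r ≡ 1ℤ
  entry² i r = ±1-square (entries i r)

  sum-quadruple² : ∀ i j k → ∑[ l < n ] (quadruple i j k l * quadruple i j k l) ≡ + n * + n
  sum-quadruple² i j k = begin
    ∑[ l < n ] (quadruple i j k l * quadruple i j k l)
      ≡⟨ AᵀA≡cI⇒∑[Ax]²≡c∑x² H (+ n) (AAᵀ≡cI⇒AᵀA≡cI H (+ n) rows-orthogonal) x ⟩
    + n * ∑[ r < n ] (x r * x r)
      ≡⟨ cong (λ t → + n * t) (trans (sum-cong-≗ x²≡1) (sum-const n 1ℤ)) ⟩
    + n * (+ n * 1ℤ)
      ≡⟨ cong (λ t → + n * t) (ℤP.*-identityʳ (+ n)) ⟩
    + n * + n
      ∎
    where
    x : Fin n → ℤ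
    x r = H i r * H j r * H k r
    square-product : ∀ a b c → (a * b * c) * (a * b * c) ≡ (a * a) * (b * b) * (c * c)
    square-product = solve-∀
    x²≡1 : ∀ r → x r * x r ≡ 1ℤ
    x²≡1 r = trans (square-product (H i r) (H j r) (H k r))
                   (cong₂ _*_ (cong₂ _*_ (entry² i r) (entry² j r)) (entry² k r))

  quadruple-repeated : ∀ {i j k l} u {v w} → v ≢ w →
    (∀ r → H i r * H j r * H k r * H l r ≡ H u r * H u r * (H v r * H w r)) →
    quadruple i j k l ≡ 0ℤ
  quadruple-repeated {i} {j} {k} {l} u {v} {w} v≢w regroup = begin
    quadruple i j k l
      ≡⟨ sum-cong-≗ regroup ⟩
    ∑[ r < n ] (H u r * H u r * (H v r * H w r))
      ≡⟨ sum-cong-≗ (λ r → trans (cong (_* (H v r * H w r)) (entry² u r)) (ℤP.*-identityˡ _)) ⟩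
    gram H v w
      ≡⟨ gram-≢ v≢w ⟩
    0ℤ
      ∎

  quadruple-ijki≡0 : ∀ {i j k} → j ≢ k → quadruple i j k i ≡ 0ℤ
  quadruple-ijki≡0 {i} {j} {k} j≢k = quadruple-repeated i j≢k (λ r → regroup (H i r) (H j r) (H k r))
    where
    regroup : ∀ a b c → a * b * c * a ≡ a * a * (b * c)
    regroup = solve-∀

  quadruple-ijkj≡0 : ∀ {i j k} → i ≢ k → quadruple i j k j ≡ 0ℤ
  quadruple-ijkj≡0 {i} {j} {k} i≢k = quadruple-repeated j i≢k (λ r → regroup (H i r) (H j r) (H k r))
    where
    regroup : ∀ a b c → a * b * c * b ≡ b * b * (a * c)
    regroup = solve-∀

  quadruple-ijkk≡0 : ∀ {i j k} → i ≢ j → quadruple i j k k ≡ 0ℤ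
  quadruple-ijkk≡0 {i} {j} {k} i≢j = quadruple-repeated k i≢j (λ r → regroup (H i r) (H j r) (H k r))
    where
    regroup : ∀ a b c → a * b * c * c ≡ c * c * (a * b)
    regroup = solve-∀

[3+m]²≡m*p² : ∀ {m} {H : Matrix (3 ℕ.+ m)} → IsHadamard (3 ℕ.+ m) H →
              ∀ p → (∀ l → P (3 ℕ.+ m) H 0F 1F 2F (suc (suc (suc l))) ≡ p) →
              (3 ℕ.+ m) ℕ.* (3 ℕ.+ m) ≡ m ℕ.* (p ℕ.* p)
[3+m]²≡m*p² {m} {H} hadamard p P≡p = ℤP.+-injective (begin
  + ((3 ℕ.+ m) ℕ.* (3 ℕ.+ m))
    ≡⟨ ℤP.pos-* (3 ℕ.+ m) (3 ℕ.+ m) ⟩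
  + (3 ℕ.+ m) * + (3 ℕ.+ m)
    ≡⟨ sum-quadruple² 0F 1F 2F ⟨
  q 0F * q 0F + (q 1F * q 1F + (q 2F * q 2F + ∑[ l < m ] (q (3+ l) * q (3+ l))))
    ≡⟨ cong₂ (λ a b → a * a + b) (quadruple-ijki≡0 (λ ()))
         (cong₂ (λ a b → a * a + b) (quadruple-ijkj≡0 (λ ()))
           (cong₂ (λ a b → a * a + b) (quadruple-ijkk≡0 (λ ())) refl)) ⟩
  0ℤ + (0ℤ + (0ℤ + ∑[ l < m ] (q (3+ l) * q (3+ l))))
    ≡⟨ trans (ℤP.+-identityˡ _) (trans (ℤP.+-identityˡ _) (ℤP.+-identityˡ _)) ⟩
  ∑[ l < m ] (q (3+ l) * q (3+ l))
    ≡⟨ sum-cong-≗ (λ l → trans (i*i≡∣i∣*∣i∣ (q (3+ l)))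
         (cong (λ a → + (a ℕ.* a)) (trans (sym (P≡∣quadruple∣ 0F 1F 2F (3+ l))) (P≡p l)))) ⟩
  ∑[ l < m ] (+ (p ℕ.* p))
    ≡⟨ sum-const m (+ (p ℕ.* p)) ⟩
  + m * + (p ℕ.* p)
    ≡⟨ ℤP.pos-* m (p ℕ.* p) ⟨
  + (m ℕ.* (p ℕ.* p))
    ∎)
  where
  open Hadamard hadamard
  q : Fin (3 ℕ.+ m) → ℤ
  q = quadruple 0F 1F 2F
  3+_ : Fin m → Fin (3 ℕ.+ m)
  3+ l = suc (suc (suc l))

corollary2p5 : (n : ℕ) → n ≥ 4 → (H : Matrix n) → IsHadamard n H →
    AllSameType n H → (n ≡ 4) ⊎ (n ≡ 12)
corollary2p5 _ (s≤s (s≤s (s≤s (s≤s {n = k} _)))) H hadamard same-type =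
  Sum.map (cong (3 ℕ.+_)) (cong (3 ℕ.+_))
    ([3+m]²≡m*p²⇒m≡1⊎m≡9 (suc k) p ([3+m]²≡m*p² hadamard p P≡p))
  where
  distinct : ∀ l → Distinct4 0F 1F 2F (suc (suc (suc l)))
  distinct _ = (λ ()) , (λ ()) , (λ ()) , (λ ()) , (λ ()) , (λ ())
  p : ℕ
  p = P _ H 0F 1F 2F 3F
  P≡p : ∀ l → P _ H 0F 1F 2F (suc (suc (suc l))) ≡ p
  P≡p l = T-injective H (same-type _ _ _ _ _ _ _ _ (distinct l) (distinct 0F))
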